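{- There is no perfect Euler box one of whose side lengths is a semiprime. That is, there do not exist positive integers $a,b,c$ such that $a^2+b^2$, $a^2+c^2$, $b^2+c^2$ and $a^2+b^2+c^2$ are all perfect squares and such that at least one of $a,b,c$ is a product of exactly two primes.
   Context: A perfect Euler box is a rectangular cuboid with positive integer side lengths $a,b,c$ whose three face diagonals $\sqrt{a^2+b^2},\sqrt{a^2+c^2},\sqrt{b^2+c^2}$ and whose space diagonal $\sqrt{a^2+b^2+c^2}$ are all integers. A semiprime is an integer of the form $pq$ with $p,q$ primes. -}

module Defs where

open import Data.Nat using (ℕ; _+_; _*_; _^_; NonZero)
open import Data.Nat.Primality using (Prime)
open import Data.Product using (Σ; ∃; _×_)
open import Relation.Binary.PropositionalEquality using (_≡_)

IsSquare : ℕ → Set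
IsSquare n = ∃ λ k → k * k ≡ n

Semiprime : ℕ → Set
Semiprime n = ∃ λ p → ∃ λ q → Prime p × Prime q × n ≡ p * q

record PerfectEulerBox (a b c : ℕ) : Set where
  field
    a-pos : NonZero a
    b-pos : NonZero b
    c-pos : NonZero c
    ab-sq : IsSquare (a ^ 2 + b ^ 2)
    ac-sq : IsSquare (a ^ 2 + c ^ 2)
    bc-sq : IsSquare (b ^ 2 + c ^ 2)
    abc-sq : IsSquare (a ^ 2 + b ^ 2 + c ^ 2)

-- Let a = pq be a side and b, c the other two sides, with face diagonal f = √(b² + c²). Each of
-- b, c, f is a leg of a right triangle whose other leg is a (for f the hypotenuse is the space
-- diagonal). Writing the hypotenuse over a leg x as x + u gives u(u + 2x) = a², so the excess u
-- is a divisor of p²q² below pq, i.e. one of 1, p, q, p² (p ≤ q), and it decreases as x grows.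
-- Since f > b, c, the excess of f is the smallest, and the excesses of b and c differ because
-- b = c would make √2 rational. If the smallest is q or p², no two distinct divisors lie above it;
-- if it is p, the other two are q and p², which pin down b, c, f with (2b)² + (2c)² < (2f)²;
-- if it is 1, then a² = 2f + 1 forces 2b, 2c < f, so again b² + c² < f².
{-# OPTIONS --safe #-}
module Submission where

open import Defs
open import Data.Nat using (ℕ)
open import Data.Sum using (_⊎_)
open import Relation.Nullary using (¬_)

open import Data.Nat.Base
open import Data.Nat.Divisibility using (_∣_; divides; divides-refl; *-cancelˡ-∣; m∣m*n)
open import Data.Nat.Induction using (<-wellFounded)
open import Data.Nat.Primality
  using (Prime; euclidsLemma; prime⇒irreducible; prime⇒nonZero; prime⇒nonTrivial; prime[2])
open import Data.Nat.Properties
open import Data.Nat.Tactic.RingSolver using (solve-∀)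
open import Data.Product using (∃-syntax; _×_; _,_)
open import Data.Sum using (inj₁; inj₂; map₂; reduce)
open import Function using (_∘_)
open import Induction.WellFounded using (Acc; acc)
open import Relation.Binary.PropositionalEquality
open import Relation.Nullary using (contradiction)

private
  variable
    a b c f k m n p q u u′ v w x x′ : ℕ

m*m≤n*n⇒m≤n : m * m ≤ n * n → m ≤ n
m*m≤n*n⇒m≤n mm≤nn = ≮⇒≥ λ n<m → <⇒≱ (*-mono-< n<m n<m) mm≤nn

m*m<n*n⇒m<n : m * m < n * n → m < n
m*m<n*n⇒m<n mm<nn = ≰⇒> λ n≤m → <⇒≱ mm<nn (*-mono-≤ n≤m n≤m)

leg<hypotenuse : .{{NonZero c}} → b * b + c * c ≡ f * f → b < f
leg<hypotenuse {c} {b} eq =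
  m*m<n*n⇒m<n (subst (b * b <_) eq (m<m+n (b * b) (>-nonZero⁻¹ (c * c) {{m*n≢0 c c}})))

f²≡2b²⇒b≡0 : f * f ≡ 2 * (b * b) → b ≡ 0
f²≡2b²⇒b≡0 {f} {b} = descent (<-wellFounded b) f
  where
  even : ∀ k m → k * k ≡ 2 * m → 2 ∣ k
  even k m eq = reduce (euclidsLemma k k prime[2] (divides m (trans eq (*-comm 2 m))))

  halve : ∀ k m → (k * 2) * (k * 2) ≡ 2 * m → m ≡ 2 * (k * k)
  halve k m eq = *-cancelˡ-≡ m (2 * (k * k)) 2 (trans (sym eq) (regroup k))
    where
    regroup : ∀ k → (k * 2) * (k * 2) ≡ 2 * (2 * (k * k))
    regroup = solve-∀

  descent : ∀ {b} → Acc _<_ b → ∀ f → f * f ≡ 2 * (b * b) → b ≡ 0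
  descent {b} (acc rec) f eq with even f (b * b) eq
  ... | divides-refl k with even b (k * k) (halve k (b * b) eq)
  ...   | divides-refl zero = refl
  ...   | divides-refl j@(suc _) =
    cong (_* 2) (descent (rec (m<m*n j 2 ≤-refl)) k (halve j (k * k) (halve k (j * 2 * (j * 2)) eq)))

m^2≡m*m : ∀ m → m ^ 2 ≡ m * m
m^2≡m*m m = cong (m *_) (*-identityʳ m)

pythagoras : ∀ m n h → h * h ≡ m ^ 2 + n ^ 2 → m * m + n * n ≡ h * h
pythagoras m n h h²≡m²+n² = trans (sym (cong₂ _+_ (m^2≡m*m m) (m^2≡m*m n))) (sym h²≡m²+n²)

open PerfectEulerBox

space-diagonal : PerfectEulerBox a b c → f * f ≡ b ^ 2 + c ^ 2 → IsSquare (a ^ 2 + f ^ 2)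
space-diagonal {a} {b} {c} {f} box f²≡b²+c² with abc-sq box
... | s , s²≡ = s , (begin
  s * s                    ≡⟨ s²≡ ⟩
  a ^ 2 + b ^ 2 + c ^ 2    ≡⟨ +-assoc (a ^ 2) (b ^ 2) (c ^ 2) ⟩
  a ^ 2 + (b ^ 2 + c ^ 2)  ≡⟨ cong (a ^ 2 +_) (trans (m^2≡m*m f) f²≡b²+c²) ⟨
  a ^ 2 + f ^ 2            ∎)
  where open ≡-Reasoning

-- a² + x² = (x + u)²
record Excess (a x u : ℕ) : Set where
  constructor excess
  field
    equation : u * (u + 2 * x) ≡ a * a

excess-exists : IsSquare (a ^ 2 + x ^ 2) → ∃[ u ] Excess a x u
excess-exists {a} {x} (h , h²≡a²+x²) = h ∸ x , excess (+-cancelˡ-≡ (x * x) _ _ (begin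
  x * x + (h ∸ x) * (h ∸ x + 2 * x)  ≡⟨ square-expand x (h ∸ x) ⟨
  (x + (h ∸ x)) * (x + (h ∸ x))      ≡⟨ cong (λ t → t * t) (m+[n∸m]≡n x≤h) ⟩
  h * h                              ≡⟨ pythagoras a x h h²≡a²+x² ⟨
  a * a + x * x                      ≡⟨ +-comm (a * a) (x * x) ⟩
  x * x + a * a                      ∎))
  where
  open ≡-Reasoning
  x≤h : x ≤ h
  x≤h = m*m≤n*n⇒m≤n (subst (x * x ≤_) (pythagoras a x h h²≡a²+x²) (m≤n+m (x * x) (a * a)))
  square-expand : ∀ x u → (x + u) * (x + u) ≡ x * x + u * (u + 2 * x)
  square-expand = solve-∀

excess-nonZero : .{{NonZero a}} → Excess a x u → NonZero u
excess-nonZero {a} {u = zero}  (excess e) =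
  contradiction (sym e) (≢-nonZero⁻¹ (a * a) {{m*n≢0 a a}})
excess-nonZero     {u = suc _} _ = _

excess⇒2*leg : .{{NonZero u}} → Excess a x u → a * a ≡ u * (u + k) → 2 * x ≡ k
excess⇒2*leg {u} (excess e) eq = +-cancelˡ-≡ u _ _ (*-cancelˡ-≡ _ _ u (trans e eq))

excess-injective : .{{NonZero u}} → Excess a x u → Excess a x′ u → x ≡ x′
excess-injective {x = x} {x′ = x′} e (excess e′) =
  *-cancelˡ-≡ x x′ 2 (excess⇒2*leg e (sym e′))

excess-antitone : .{{NonZero u′}} → Excess a x u → Excess a x′ u′ → x < x′ → u′ < u
excess-antitone {u′} {x = x} {u} {x′} (excess e) (excess e′) x<x′ =
  ≰⇒> λ u≤u′ → <-irrefl (trans e (sym e′)) (begin-strict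
    u * (u + 2 * x)     ≤⟨ *-monoˡ-≤ (u + 2 * x) u≤u′ ⟩
    u′ * (u + 2 * x)    <⟨ *-monoʳ-< u′ (+-mono-≤-< u≤u′ (*-monoʳ-< 2 x<x′)) ⟩
    u′ * (u′ + 2 * x′)  ∎)
  where open ≤-Reasoning

excess<leg : .{{NonZero a}} → .{{NonZero x}} → Excess a x u → u < a
excess<leg {a} {x} {u} (excess e) = ≰⇒> λ a≤u → <-irrefl (sym e) (begin-strict
  a * a            <⟨ *-monoʳ-< a (≤-<-trans a≤u (m<m+n u (*-monoʳ-< 2 (>-nonZero⁻¹ x)))) ⟩
  a * (u + 2 * x)  ≤⟨ *-monoˡ-≤ (u + 2 * x) a≤u ⟩
  u * (u + 2 * x)  ∎)
  where open ≤-Reasoning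

excess∣square : Excess a x u → u ∣ a * a
excess∣square {x = x} {u} (excess e) = subst (u ∣_) e (m∣m*n (u + 2 * x))

excess-1⇒2x<f : Excess a f 1 → Excess a x u → 1 < u → 2 * x < f
excess-1⇒2x<f {a} {f} {x} {u} (excess e₁) (excess e) u>1 =
  *-cancelˡ-< 2 (2 * x) f (+-cancelˡ-< 1 _ _ (begin-strict
    1 + 2 * (2 * x)        <⟨ m<n+m (1 + 2 * (2 * x)) {3} z<s ⟩
    3 + (1 + 2 * (2 * x))  ≡⟨ regroup x ⟩
    2 * (2 + 2 * x)        ≤⟨ *-mono-≤ u>1 (+-monoˡ-≤ (2 * x) u>1) ⟩
    u * (u + 2 * x)        ≡⟨ trans e (sym e₁) ⟩
    1 * (1 + 2 * f)        ≡⟨ *-identityˡ (1 + 2 * f) ⟩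
    1 + 2 * f              ∎))
  where
  open ≤-Reasoning
  regroup : ∀ x → 3 + (1 + 2 * (2 * x)) ≡ 2 * (2 + 2 * x)
  regroup = solve-∀

private
  double-legs : ∀ b c → 4 * (b * b + c * c) ≡ (2 * b) * (2 * b) + (2 * c) * (2 * c)
  double-legs = solve-∀

short-legs⇒¬right : 2 * b < f → 2 * c < f → b * b + c * c ≢ f * f
short-legs⇒¬right {b} {f} {c} 2b<f 2c<f eq = <⇒≱ (begin-strict
  (2 * b) * (2 * b) + (2 * c) * (2 * c)  <⟨ +-mono-< (*-mono-< 2b<f 2b<f) (*-mono-< 2c<f 2c<f) ⟩
  f * f + f * f                          ∎) (begin
  f * f + f * f                          ≤⟨ m≤m+n (f * f + f * f) (f * f + f * f) ⟩
  (f * f + f * f) + (f * f + f * f)      ≡⟨ quadruple (f * f) ⟩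
  4 * (f * f)                            ≡⟨ cong (4 *_) eq ⟨
  4 * (b * b + c * c)                    ≡⟨ double-legs b c ⟩
  (2 * b) * (2 * b) + (2 * c) * (2 * c)  ∎)
  where
  open ≤-Reasoning
  quadruple : ∀ m → (m + m) + (m + m) ≡ 4 * m
  quadruple = solve-∀

-- With p² = 1 + M and q² = p² + N, excesses p, q, p² of f, b, c give 2f = p(M + N), 2b = qM
-- and 2c = N, so this reads (2f)² = (2b)² + (2c)² + MN(M + N + 2).
pythagorean-gap : ∀ M N →
  (1 + M) * ((M + N) * (M + N)) ≡ (1 + M + N) * (M * M) + N * N + M * N * (2 + M + N)
pythagorean-gap = solve-∀

module _ {p q : ℕ} (1<p : 1 < p) (p<q : p < q) where
  private
    M N : ℕ
    M = p * p ∸ 1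
    N = q * q ∸ p * p

    1<p² : 1 < p * p
    1<p² = <-≤-trans 1<p (m≤m*n p p {{>-nonZero (<⇒≤ 1<p)}})

    p²<q² : p * p < q * q
    p²<q² = *-mono-< p<q p<q

    p²≡1+M : p * p ≡ 1 + M
    p²≡1+M = sym (m+[n∸m]≡n (<⇒≤ 1<p²))

    q²≡p²+N : q * q ≡ p * p + N
    q²≡p²+N = sym (m+[n∸m]≡n (<⇒≤ p²<q²))

    q²≡1+M+N : q * q ≡ 1 + M + N
    q²≡1+M+N = trans q²≡p²+N (cong (_+ N) p²≡1+M)

    instance
      p≢0 : NonZero p
      p≢0 = >-nonZero (<⇒≤ 1<p)
      q≢0 : NonZero q
      q≢0 = >-nonZero (<-trans (<⇒≤ 1<p) p<q)
      M≢0 : NonZero M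
      M≢0 = >-nonZero (m<n⇒0<n∸m 1<p²)
      N≢0 : NonZero N
      N≢0 = >-nonZero (m<n⇒0<n∸m p²<q²)

    expand : ∀ p k → p * (p * (1 + k)) ≡ p * (p + p * k)
    expand = solve-∀

    excess-p⇒2f : Excess (p * q) f p → 2 * f ≡ p * (M + N)
    excess-p⇒2f e = excess⇒2*leg e (begin
      (p * q) * (p * q)        ≡⟨ regroup p q ⟩
      p * (p * (q * q))        ≡⟨ cong (λ t → p * (p * t)) q²≡1+M+N ⟩
      p * (p * (1 + M + N))    ≡⟨ expand p (M + N) ⟩
      p * (p + p * (M + N))    ∎)
      where
      open ≡-Reasoning
      regroup : ∀ p q → (p * q) * (p * q) ≡ p * (p * (q * q))
      regroup = solve-∀

    excess-q⇒2b : Excess (p * q) b q → 2 * b ≡ q * M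
    excess-q⇒2b e = excess⇒2*leg e (begin
      (p * q) * (p * q)        ≡⟨ regroup p q ⟩
      q * (q * (p * p))        ≡⟨ cong (λ t → q * (q * t)) p²≡1+M ⟩
      q * (q * (1 + M))        ≡⟨ expand q M ⟩
      q * (q + q * M)          ∎)
      where
      open ≡-Reasoning
      regroup : ∀ p q → (p * q) * (p * q) ≡ q * (q * (p * p))
      regroup = solve-∀

    excess-p²⇒2c : Excess (p * q) c (p * p) → 2 * c ≡ N
    excess-p²⇒2c e = excess⇒2*leg {{m*n≢0 p p}} e (begin
      (p * q) * (p * q)          ≡⟨ regroup p q ⟩
      (p * p) * (q * q)          ≡⟨ cong ((p * p) *_) q²≡p²+N ⟩
      (p * p) * (p * p + N)      ∎)
      where
      open ≡-Reasoning
      regroup : ∀ p q → (p * q) * (p * q) ≡ (p * p) * (q * q)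
      regroup = solve-∀

  excesses-p-q-p²⇒¬right :
    Excess (p * q) f p → Excess (p * q) b q → Excess (p * q) c (p * p) → b * b + c * c ≢ f * f
  excesses-p-q-p²⇒¬right {f} {b} {c} ef eb ec eq = <-irrefl (cong (4 *_) eq) (begin-strict
    4 * (b * b + c * c)                                  ≡⟨ double-legs b c ⟩
    (2 * b) * (2 * b) + (2 * c) * (2 * c)
      ≡⟨ cong₂ (λ s t → s * s + t * t) (excess-q⇒2b eb) (excess-p²⇒2c ec) ⟩
    (q * M) * (q * M) + N * N                            ≡⟨ cong (_+ N * N) (square-* q M) ⟩
    (q * q) * (M * M) + N * N                            ≡⟨ cong (λ t → t * (M * M) + N * N) q²≡1+M+N ⟩
    (1 + M + N) * (M * M) + N * N                        <⟨ m<m+n _ gap>0 ⟩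
    (1 + M + N) * (M * M) + N * N + M * N * (2 + M + N)  ≡⟨ pythagorean-gap M N ⟨
    (1 + M) * ((M + N) * (M + N))                        ≡⟨ cong (_* ((M + N) * (M + N))) p²≡1+M ⟨
    (p * p) * ((M + N) * (M + N))                        ≡⟨ square-* p (M + N) ⟨
    (p * (M + N)) * (p * (M + N))                        ≡⟨ cong (λ t → t * t) (excess-p⇒2f ef) ⟨
    (2 * f) * (2 * f)                                    ≡⟨ square-* 2 f ⟩
    4 * (f * f)                                          ∎)
    where
    open ≤-Reasoning
    gap>0 : 0 < M * N * (2 + M + N)
    gap>0 = >-nonZero⁻¹ _ {{m*n≢0 (M * N) (2 + M + N) {{m*n≢0 M N}}}}
    square-* : ∀ m n → (m * n) * (m * n) ≡ (m * m) * (n * n)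
    square-* = solve-∀

∣p*n⇒∣n⊎≡p* : Prime p → m ∣ p * n → m ∣ n ⊎ ∃[ k ] m ≡ p * k × k ∣ n
∣p*n⇒∣n⊎≡p* {p} {m} {n} pp (divides k pn≡km)
  with euclidsLemma k m pp (divides n (trans (sym pn≡km) (*-comm p n)))
... | inj₁ (divides-refl j) =
  inj₁ (*-cancelˡ-∣ p {{prime⇒nonZero pp}} (divides j (trans pn≡km (*-assoc j p m))))
... | inj₂ (divides-refl j) =
  inj₂ (j , *-comm j p ,
    *-cancelˡ-∣ p {{prime⇒nonZero pp}} (divides k (trans pn≡km (cong (k *_) (*-comm j p)))))

∣p*p⇒≡1⊎≡p⊎≡p*p : Prime p → m ∣ p * p → m ≡ 1 ⊎ m ≡ p ⊎ m ≡ p * p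
∣p*p⇒≡1⊎≡p⊎≡p*p pp m∣pp with ∣p*n⇒∣n⊎≡p* pp m∣pp
... | inj₁ m∣p = map₂ inj₁ (prime⇒irreducible pp m∣p)
... | inj₂ (k , refl , k∣p) with prime⇒irreducible pp k∣p
...   | inj₁ refl = inj₂ (inj₁ (*-identityʳ _))
...   | inj₂ refl = inj₂ (inj₂ refl)

data SmallDivisor (p q : ℕ) : ℕ → Set where
  d=1  : SmallDivisor p q 1
  d=p  : SmallDivisor p q p
  d=q  : SmallDivisor p q q
  d=p² : SmallDivisor p q (p * p)

module _ {p q : ℕ} (p-prime : Prime p) (q-prime : Prime q) (p≤q : p ≤ q) where
  private
    instance
      p≢0 : NonZero p
      p≢0 = prime⇒nonZero p-prime
      q≢0 : NonZero q
      q≢0 = prime⇒nonZero q-prime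

    1<p : 1 < p
    1<p = nonTrivial⇒n>1 p {{prime⇒nonTrivial p-prime}}

    regroup : ∀ p q → (p * q) * (p * q) ≡ p * (p * (q * q))
    regroup = solve-∀

    ∣q*q∧<q⇒≡1 : m ∣ q * q → m < q → m ≡ 1
    ∣q*q∧<q⇒≡1 m∣qq m<q with ∣p*p⇒≡1⊎≡p⊎≡p*p q-prime m∣qq
    ... | inj₁ m≡1         = m≡1
    ... | inj₂ (inj₁ refl) = contradiction m<q (<-irrefl refl)
    ... | inj₂ (inj₂ refl) = contradiction m<q (≤⇒≯ (m≤m*n q q))

    q-part : m ∣ q * q → m < p * q → SmallDivisor p q m
    q-part m∣qq m<pq with ∣p*p⇒≡1⊎≡p⊎≡p*p q-prime m∣qq
    ... | inj₁ refl         = d=1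
    ... | inj₂ (inj₁ refl)  = d=q
    ... | inj₂ (inj₂ refl)  = contradiction (*-cancelʳ-< q q p m<pq) (≤⇒≯ p≤q)

    p-part : m ∣ q * q → p * m < p * q → SmallDivisor p q (p * m)
    p-part m∣qq pm<pq with ∣q*q∧<q⇒≡1 m∣qq (*-cancelˡ-< p _ _ pm<pq)
    ... | refl = subst (SmallDivisor p q) (sym (*-identityʳ p)) d=p

    p²-part : m ∣ q * q → p * (p * m) < p * q → SmallDivisor p q (p * (p * m))
    p²-part {m} m∣qq ppm<pq
      with ∣q*q∧<q⇒≡1 m∣qq (≤-<-trans (m≤n*m m p) (*-cancelˡ-< p _ _ ppm<pq))
    ... | refl = subst (SmallDivisor p q) (cong (p *_) (sym (*-identityʳ p))) d=p²

  small-divisor : u ∣ (p * q) * (p * q) → u < p * q → SmallDivisor p q u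
  small-divisor {u} u∣ u<pq with ∣p*n⇒∣n⊎≡p* p-prime (subst (u ∣_) (regroup p q) u∣)
  ... | inj₁ u∣p[qq] with ∣p*n⇒∣n⊎≡p* p-prime u∣p[qq]
  ...   | inj₁ u∣qq                 = q-part u∣qq u<pq
  ...   | inj₂ (k , refl , k∣qq)    = p-part k∣qq u<pq
  small-divisor u∣ u<pq | inj₂ (k , refl , k∣p[qq]) with ∣p*n⇒∣n⊎≡p* p-prime k∣p[qq]
  ...   | inj₁ k∣qq                 = p-part k∣qq u<pq
  ...   | inj₂ (j , refl , j∣qq)    = p²-part j∣qq u<pq

  private
    above-p : SmallDivisor p q u → p < u → u ≡ q ⊎ u ≡ p * p
    above-p d=1  p<1 = contradiction p<1 (<-asym 1<p)
    above-p d=p  p<p = contradiction p<p (<-irrefl refl)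
    above-p d=q  _   = inj₁ refl
    above-p d=p² _   = inj₂ refl

    above-q : SmallDivisor p q u → q < u → u ≡ p * p
    above-q d=1  q<1 = contradiction q<1 (<-asym (<-≤-trans 1<p p≤q))
    above-q d=p  q<p = contradiction q<p (≤⇒≯ p≤q)
    above-q d=q  q<q = contradiction q<q (<-irrefl refl)
    above-q d=p² _   = refl

    above-p² : SmallDivisor p q u → p * p < u → u ≡ q
    above-p² d=1  pp<1  = contradiction pp<1 (<-asym (<-≤-trans 1<p (m≤m*n p p)))
    above-p² d=p  pp<p  = contradiction pp<p (≤⇒≯ (m≤m*n p p))
    above-p² d=q  _     = refl
    above-p² d=p² pp<pp = contradiction pp<pp (<-irrefl refl)

  small-excesses⇒¬right : SmallDivisor p q u → SmallDivisor p q v → SmallDivisor p q w →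
    u < v → u < w → v ≢ w →
    Excess (p * q) f u → Excess (p * q) b v → Excess (p * q) c w → b * b + c * c ≢ f * f
  small-excesses⇒¬right {b = b} {c = c} d=1 _ _ 1<v 1<w _ ef eb ec =
    short-legs⇒¬right {b} {c = c} (excess-1⇒2x<f ef eb 1<v) (excess-1⇒2x<f ef ec 1<w)
  small-excesses⇒¬right {b = b} {c = c} d=p dv dw p<v p<w v≢w ef eb ec
    with above-p dv p<v | above-p dw p<w
  ... | inj₁ refl | inj₁ refl = contradiction refl v≢w
  ... | inj₂ refl | inj₂ refl = contradiction refl v≢w
  ... | inj₁ refl | inj₂ refl = excesses-p-q-p²⇒¬right 1<p p<v ef eb ec
  ... | inj₂ refl | inj₁ refl =
    excesses-p-q-p²⇒¬right 1<p p<w ef ec eb ∘ trans (+-comm (c * c) (b * b))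
  small-excesses⇒¬right d=q dv dw q<v q<w v≢w _ _ _ _ =
    v≢w (trans (above-q dv q<v) (sym (above-q dw q<w)))
  small-excesses⇒¬right d=p² dv dw p²<v p²<w v≢w _ _ _ _ =
    v≢w (trans (above-p² dv p²<v) (sym (above-p² dw p²<w)))

  private
    instance
      pq≢0 : NonZero (p * q)
      pq≢0 = m*n≢0 p q

    small-excess : .{{NonZero x}} → Excess (p * q) x u → SmallDivisor p q u
    small-excess e = small-divisor (excess∣square e) (excess<leg e)

  ¬perfectEulerBox : ¬ PerfectEulerBox (p * q) b c
  ¬perfectEulerBox {b} {c} box with bc-sq box
  ... | f , f²≡b²+c²
    with excess-exists (ab-sq box) | excess-exists (ac-sq box)
       | excess-exists (space-diagonal {f = f} box f²≡b²+c²)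
  ... | ub , eb | uc , ec | uf , ef = small-excesses⇒¬right
    (small-excess ef) (small-excess eb) (small-excess ec) uf<ub uf<uc ub≢uc ef eb ec bc≡f
    where
    instance
      b≢0 = b-pos box
      c≢0 = c-pos box
      uf≢0 = excess-nonZero ef
    bc≡f : b * b + c * c ≡ f * f
    bc≡f = pythagoras b c f f²≡b²+c²
    b<f : b < f
    b<f = leg<hypotenuse bc≡f
    instance
      f≢0 = >-nonZero (≤-<-trans z≤n b<f)
    uf<ub : uf < ub
    uf<ub = excess-antitone eb ef b<f
    uf<uc : uf < uc
    uf<uc = excess-antitone ec ef (leg<hypotenuse {c = b} (trans (+-comm (c * c) (b * b)) bc≡f))
    ub≢uc : ub ≢ uc
    ub≢uc refl = ≢-nonZero⁻¹ b (f²≡2b²⇒b≡0 {f} (begin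
      f * f          ≡⟨ bc≡f ⟨
      b * b + c * c  ≡⟨ cong (λ t → b * b + t * t) (excess-injective {{excess-nonZero eb}} ec eb) ⟩
      b * b + b * b  ≡⟨ cong (b * b +_) (+-identityʳ (b * b)) ⟨
      2 * (b * b)    ∎))
      where open ≡-Reasoning

swap-box : PerfectEulerBox a b c → PerfectEulerBox b a c
swap-box {a} {b} {c} box = record
  { a-pos  = b-pos box
  ; b-pos  = a-pos box
  ; c-pos  = c-pos box
  ; ab-sq  = subst IsSquare (+-comm (a ^ 2) (b ^ 2)) (ab-sq box)
  ; ac-sq  = bc-sq box
  ; bc-sq  = ac-sq box
  ; abc-sq = subst IsSquare (cong (_+ c ^ 2) (+-comm (a ^ 2) (b ^ 2))) (abc-sq box)
  }

rotate-box : PerfectEulerBox a b c → PerfectEulerBox c a b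
rotate-box {a} {b} {c} box = record
  { a-pos  = c-pos box
  ; b-pos  = a-pos box
  ; c-pos  = b-pos box
  ; ab-sq  = subst IsSquare (+-comm (a ^ 2) (c ^ 2)) (ac-sq box)
  ; ac-sq  = subst IsSquare (+-comm (b ^ 2) (c ^ 2)) (bc-sq box)
  ; bc-sq  = ab-sq box
  ; abc-sq = subst IsSquare
      (trans (+-comm (a ^ 2 + b ^ 2) (c ^ 2)) (sym (+-assoc (c ^ 2) (a ^ 2) (b ^ 2)))) (abc-sq box)
  }

¬semiprime-side : PerfectEulerBox a b c → ¬ Semiprime a
¬semiprime-side {b = b} {c} box (p , q , p-prime , q-prime , refl) with ≤-total p q
... | inj₁ p≤q = ¬perfectEulerBox p-prime q-prime p≤q box
... | inj₂ q≤p =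
  ¬perfectEulerBox q-prime p-prime q≤p (subst (λ a → PerfectEulerBox a b c) (*-comm p q) box)

theorem1 : (a b c : ℕ) → PerfectEulerBox a b c → ¬ (Semiprime a ⊎ Semiprime b ⊎ Semiprime c)
theorem1 a b c box (inj₁ a-semiprime)         = ¬semiprime-side box a-semiprime
theorem1 a b c box (inj₂ (inj₁ b-semiprime)) = ¬semiprime-side (swap-box box) b-semiprime
theorem1 a b c box (inj₂ (inj₂ c-semiprime)) = ¬semiprime-side (rotate-box box) c-semiprime
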